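{- Let $G=(V,E,w)$ be an undirected graph with positive integer edge weights $w:E\to\mathbb{N}_{>0}$, and let $T=\{t_1,\dots,t_k\}\subseteq V$ be a set of $k\ge 2$ terminals. Let $\mathcal{C}(G)$ be a minimum multiterminal cut of $G$ with respect to $T$, of weight $\mathcal{W}(G)=w(\mathcal{C}(G))$. If $u,v\in V$ belong to different connected components of the graph $G\setminus\mathcal{C}(G)$ (obtained from $G$ by removing the edges of $\mathcal{C}(G)$), then $$\lambda(u,v)+\frac{\sum_{i\in\{1,\dots,k\}\setminus \max_2}\lambda(G,t_i,T\setminus\{t_i\})}{4}\;\le\;\mathcal{W}(G),$$ where $\max_2$ denotes the set of the indices $i$ of the two largest values $\lambda(G,t_i,T\setminus\{t_i\})$.
   Context: For a set of edges $E'\subseteq E$, $w(E')=\sum_{e\in E'}w(e)$. A multiterminal cut for terminals $T=\{t_1,\dots,t_k\}$ is a partition of $V$ into $k$ disjoint blocks $V_1,\dots,V_k$ with $t_i\in V_i$ for all $i$; its edge set is the set of edges whose endpoints lie in different blocks, and its weight is the total weight of that edge set. A minimum multiterminal cut is one of minimum weight; $\mathcal{C}(G)$ denotes its edge set and $\mathcal{W}(G)$ its weight. $\lambda(u,v)$ denotes the minimum total weight of a set of edges whose removal separates $u$ from $v$ in $G$. For a vertex $s$ and a nonempty vertex set $S$, $\lambda(G,s,S)$ denotes the minimum weight of an edge cut of $G$ with $s$ on one side and all vertices of $S$ on the other side (minimum $s$-$S$-cut). -}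

module Defs where

open import Data.Nat using (ℕ; zero; suc; _+_; _*_; _≤_; _<_)
open import Data.Fin using (Fin; zero; suc; _≟_)
open import Data.Bool using (Bool; true; false; if_then_else_; not)
open import Data.Product using (Σ; ∃; _×_; _,_)
open import Relation.Binary.PropositionalEquality using (_≡_; _≢_)
open import Relation.Nullary using (¬_)
open import Relation.Nullary.Decidable using (⌊_⌋)

sumFin : (m : ℕ) → (Fin m → ℕ) → ℕ
sumFin zero    f = 0
sumFin (suc m) f = f zero + sumFin m (λ i → f (suc i))

record Edge (n : ℕ) : Set where
  constructor edge
  field
    src    : Fin n
    dst    : Fin n
    weight : ℕ

record Graph (n m : ℕ) : Set where
  field
    edges    : Fin m → Edge n
    positive : (e : Fin m) → 0 < Edge.weight (edges e)

module _ {n m : ℕ} (G : Graph n m) where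
  open Graph G

  src : Fin m → Fin n
  src e = Edge.src (edges e)

  dst : Fin m → Fin n
  dst e = Edge.dst (edges e)

  w : Fin m → ℕ
  w e = Edge.weight (edges e)

  EdgeSet : Set
  EdgeSet = Fin m → Bool

  weightOf : EdgeSet → ℕ
  weightOf R = sumFin m (λ e → if R e then w e else 0)

  -- Reach R u v : v is reachable from u in G ∖ R (edges in R removed).
  data Reach (R : EdgeSet) (u : Fin n) : Fin n → Set where
    here : Reach R u u
    fwd  : (e : Fin m) → R e ≡ false → Reach R u (src e) → Reach R u (dst e)
    bwd  : (e : Fin m) → R e ≡ false → Reach R u (dst e) → Reach R u (src e)

  -- Multiterminal cut: partition f : V → Fin k (block index) with t i ∈ V_i.
  IsMultiterminalCut : {k : ℕ} → (Fin k → Fin n) → (Fin n → Fin k) → Set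
  IsMultiterminalCut t f = ∀ i → f (t i) ≡ i

  cutEdges : {k : ℕ} → (Fin n → Fin k) → EdgeSet
  cutEdges f e = not ⌊ f (src e) ≟ f (dst e) ⌋

  IsMinMultiterminalCut : {k : ℕ} → (Fin k → Fin n) → (Fin n → Fin k) → Set
  IsMinMultiterminalCut t f =
    IsMultiterminalCut t f ×
    (∀ g → IsMultiterminalCut t g → weightOf (cutEdges f) ≤ weightOf (cutEdges g))

  IsLambda : Fin n → Fin n → ℕ → Set
  IsLambda u v a =
    (Σ EdgeSet λ R → ¬ Reach R u v × weightOf R ≡ a) ×
    (∀ (R : EdgeSet) → ¬ Reach R u v → a ≤ weightOf R)

  boundary : (Fin n → Bool) → EdgeSet
  boundary X e = not ⌊ Data.Bool._≟_ (X (src e)) (X (dst e)) ⌋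
    where import Data.Bool

  IsLambdaSet : Fin n → (Fin n → Set) → ℕ → Set
  IsLambdaSet s S a =
    (Σ (Fin n → Bool) λ X → X s ≡ true × (∀ x → S x → X x ≡ false) × weightOf (boundary X) ≡ a) ×
    (∀ (X : Fin n → Bool) → X s ≡ true → (∀ x → S x → X x ≡ false) → a ≤ weightOf (boundary X))

OtherTerminals : {n k : ℕ} → (Fin k → Fin n) → Fin k → Fin n → Set
OtherTerminals t i x = ∃ λ j → j ≢ i × t j ≡ x

sumExcept2 : {k : ℕ} → (Fin k → ℕ) → Fin k → Fin k → ℕ
sumExcept2 {k} b i₁ i₂ =
  sumFin k (λ l → if ⌊ l ≟ i₁ ⌋ then 0 else (if ⌊ l ≟ i₂ ⌋ then 0 else b l))

-- Proof by packing.  Let p, q be the blocks of u, v and X, Y their components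
-- in G ∖ C.  The sets X, Y and Vᵢ (i ∉ {p,q}) are pairwise disjoint and have
-- their boundaries inside C; an edge has two endpoints, so it lies on at most
-- two of these boundaries and their weights sum to at most 2·w(C)
-- (packing-lemma).  ∂X and ∂Y separate u from v, so each weighs ≥ λ(u,v);
-- ∂Vᵢ separates tᵢ from T∖tᵢ, so it weighs ≥ λᵢ.  Hence
-- 2λ(u,v) + Σ_{i ∉ {p,q}} λᵢ ≤ 2·w(C); excluding the two largest λᵢ instead
-- of λ_p, λ_q only lowers the sum (sumExcept2-minimal), and doubling gives
-- the claim.  Components need a decision
-- procedure for reachability; the goal is a decidable inequality, so one may
-- be assumed under double negation (¬¬-decide-all).
module Submission where

open import Defs
open import Data.Nat using (ℕ; zero; suc; _+_; _*_; _≤_; _≤?_; z≤n; s≤s)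
open import Data.Nat.Properties hiding (_≟_)
open import Data.Fin using (Fin; zero; suc; _≟_)
open import Data.Bool using (Bool; true; false; if_then_else_; _∧_)
open import Data.Product using (_×_; _,_; proj₁; proj₂)
open import Function using (_∘_)
open import Relation.Binary.PropositionalEquality
open import Relation.Nullary using (¬_; Dec; yes; no; contradiction)
open import Relation.Nullary.Decidable using (⌊_⌋; decidable-stable; ¬¬-excluded-middle)
open import Function.Definitions using (Injective)
open import Data.Nat.Solver using (module +-*-Solver)
open +-*-Solver

sum-cong : ∀ m {f g : Fin m → ℕ} → (∀ i → f i ≡ g i) → sumFin m f ≡ sumFin m g
sum-cong zero    h = refl
sum-cong (suc m) h = cong₂ _+_ (h zero) (sum-cong m (h ∘ suc))

sum-mono : ∀ m {f g : Fin m → ℕ} → (∀ i → f i ≤ g i) → sumFin m f ≤ sumFin m g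
sum-mono zero    h = z≤n
sum-mono (suc m) h = +-mono-≤ (h zero) (sum-mono m (h ∘ suc))

sum-zero : ∀ m → sumFin m (λ _ → 0) ≡ 0
sum-zero zero    = refl
sum-zero (suc m) = sum-zero m

sum-+ : ∀ m (f g : Fin m → ℕ) → sumFin m (λ i → f i + g i) ≡ sumFin m f + sumFin m g
sum-+ zero    f g = refl
sum-+ (suc m) f g =
  trans (cong (f zero + g zero +_) (sum-+ m (f ∘ suc) (g ∘ suc)))
        (+-+-interchange (f zero) (g zero) _ _)
  where
  +-+-interchange : ∀ a b c d → (a + b) + (c + d) ≡ (a + c) + (b + d)
  +-+-interchange = solve 4 (λ a b c d → (a :+ b) :+ (c :+ d) := (a :+ c) :+ (b :+ d)) refl

sum-* : ∀ m c (f : Fin m → ℕ) → sumFin m (λ i → c * f i) ≡ c * sumFin m f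
sum-* zero    c f = sym (*-zeroʳ c)
sum-* (suc m) c f = trans (cong (c * f zero +_) (sum-* m c (f ∘ suc)))
                          (sym (*-distribˡ-+ c (f zero) _))

sum-swap : ∀ r m (g : Fin r → Fin m → ℕ) →
  sumFin r (λ j → sumFin m (g j)) ≡ sumFin m (λ e → sumFin r (λ j → g j e))
sum-swap zero    m g = sym (sum-zero m)
sum-swap (suc r) m g =
  trans (cong (sumFin m (g zero) +_) (sum-swap r m (g ∘ suc)))
        (sym (sum-+ m (g zero) (λ e → sumFin r (λ j → g (suc j) e))))

≟-suc : ∀ {k} (c i : Fin k) → ⌊ suc c ≟ suc i ⌋ ≡ ⌊ c ≟ i ⌋
≟-suc c i with c ≟ i
... | yes _ = refl
... | no  _ = refl

≟-refl : ∀ {k} (p : Fin k) → ⌊ p ≟ p ⌋ ≡ true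
≟-refl p with p ≟ p
... | yes _  = refl
... | no p≢p = contradiction refl p≢p

≟-≢ : ∀ {k} {p q : Fin k} → p ≢ q → ⌊ p ≟ q ⌋ ≡ false
≟-≢ {p = p} {q} p≢q with p ≟ q
... | yes p≡q = contradiction p≡q p≢q
... | no  _   = refl

sum-point : ∀ k (c : Fin k) (h : Fin k → ℕ) →
  sumFin k (λ i → if ⌊ c ≟ i ⌋ then h i else 0) ≡ h c
sum-point (suc k) zero    h = trans (cong (h zero +_) (sum-zero k)) (+-identityʳ (h zero))
sum-point (suc k) (suc c) h =
  trans (sum-cong k (λ i → cong (λ z → if z then h (suc i) else 0) (≟-suc c i)))
        (sum-point k c (h ∘ suc))

sum-drop : ∀ k (p : Fin k) (h : Fin k → ℕ) →
  sumFin k (λ l → if ⌊ l ≟ p ⌋ then 0 else h l) + h p ≡ sumFin k h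
sum-drop (suc k) zero    h = +-comm (sumFin k (h ∘ suc)) (h zero)
sum-drop (suc k) (suc p) h =
  trans (+-assoc (h zero) _ (h (suc p)))
    (cong (h zero +_)
      (trans (cong (_+ h (suc p))
               (sum-cong k (λ i → cong (λ z → if z then 0 else h (suc i)) (≟-suc i p))))
             (sum-drop k p (h ∘ suc))))

-- The value of the pair {p, q} (counted once when p = q).
pairValue : ∀ {k} → (Fin k → ℕ) → Fin k → Fin k → ℕ
pairValue b p q = (if ⌊ p ≟ q ⌋ then 0 else b p) + b q

sumExcept2-split : ∀ k (b : Fin k → ℕ) (p q : Fin k) →
  sumExcept2 b p q + pairValue b p q ≡ sumFin k b
sumExcept2-split k b p q =
  trans (sym (+-assoc (sumExcept2 b p q) _ (b q)))
        (trans (cong (_+ b q) (sum-drop k p (λ l → if ⌊ l ≟ q ⌋ then 0 else b l)))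
               (sum-drop k q b))

pairValue-max : ∀ {k} (b : Fin k → ℕ) {i₁ i₂ : Fin k} →
  (∀ l → l ≢ i₁ → l ≢ i₂ → (b l ≤ b i₁) × (b l ≤ b i₂)) →
  ∀ p q → pairValue b p q ≤ b i₁ + b i₂
pairValue-max b {i₁} {i₂} largest p q = bound (p ≟ q)
  where
  below₁ : ∀ x → x ≢ i₂ → b x ≤ b i₁
  below₁ x x≢i₂ with x ≟ i₁
  ... | yes refl  = ≤-refl
  ... | no  x≢i₁ = proj₁ (largest x x≢i₁ x≢i₂)
  below₂ : ∀ x → x ≢ i₁ → b x ≤ b i₂
  below₂ x x≢i₁ with x ≟ i₂
  ... | yes refl  = ≤-refl
  ... | no  x≢i₂ = proj₂ (largest x x≢i₁ x≢i₂)
  single : b q ≤ b i₁ + b i₂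
  single with q ≟ i₂
  ... | yes refl  = m≤n+m (b i₂) (b i₁)
  ... | no  q≢i₂ = ≤-trans (below₁ q q≢i₂) (m≤m+n (b i₁) (b i₂))
  distinct : p ≢ q → b p + b q ≤ b i₁ + b i₂
  distinct p≢q with p ≟ i₂ | q ≟ i₁
  ... | yes refl | _ = subst (b i₂ + b q ≤_) (+-comm (b i₂) (b i₁))
                         (+-monoʳ-≤ (b i₂) (below₁ q (p≢q ∘ sym)))
  ... | no _ | yes refl = subst (b p + b i₁ ≤_) (+-comm (b i₂) (b i₁))
                            (+-monoˡ-≤ (b i₁) (below₂ p p≢q))
  ... | no p≢i₂ | no q≢i₁ = +-mono-≤ (below₁ p p≢i₂) (below₂ q q≢i₁)
  bound : (p≟q : Dec (p ≡ q)) → (if ⌊ p≟q ⌋ then 0 else b p) + b q ≤ b i₁ + b i₂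
  bound (yes _)   = single
  bound (no p≢q) = distinct p≢q

sumExcept2-minimal : ∀ k (b : Fin k → ℕ) {i₁ i₂ : Fin k} → i₁ ≢ i₂ →
  (∀ l → l ≢ i₁ → l ≢ i₂ → (b l ≤ b i₁) × (b l ≤ b i₂)) →
  ∀ p q → sumExcept2 b i₁ i₂ ≤ sumExcept2 b p q
sumExcept2-minimal k b {i₁} {i₂} i₁≢i₂ largest p q =
  +-cancelʳ-≤ (b i₁ + b i₂) _ _
    (≤-trans (≤-reflexive (trans same-total (sym (sumExcept2-split k b p q))))
             (+-monoʳ-≤ (sumExcept2 b p q) (pairValue-max b largest p q)))
  where
  same-total : sumExcept2 b i₁ i₂ + (b i₁ + b i₂) ≡ sumFin k b
  same-total = subst (λ z → sumExcept2 b i₁ i₂ + ((if z then 0 else b i₁) + b i₂) ≡ sumFin k b)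
                     (≟-≢ i₁≢i₂) (sumExcept2-split k b i₁ i₂)

-- Classically every predicate on a finite set is decidable; constructively
-- this holds under double negation, which suffices for a decidable goal.
¬¬-decide-all : ∀ n (P : Fin n → Set) → ¬ ¬ (∀ x → Dec (P x))
¬¬-decide-all zero    P k = k (λ ())
¬¬-decide-all (suc n) P k =
  ¬¬-excluded-middle λ P0? →
  ¬¬-decide-all n (P ∘ suc) λ P+? →
  k λ { zero → P0? ; (suc x) → P+? x }

ι : Bool → ℕ
ι true  = 1
ι false = 0

module Cuts {n m : ℕ} (G : Graph n m) where

  reach-trans : ∀ {R u x y} → Reach G R u x → Reach G R x y → Reach G R u y
  reach-trans p here         = p
  reach-trans p (fwd e eq q) = fwd e eq (reach-trans p q)
  reach-trans p (bwd e eq q) = bwd e eq (reach-trans p q)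

  reach-sym : ∀ {R u x} → Reach G R u x → Reach G R x u
  reach-sym here         = here
  reach-sym (fwd e eq q) = reach-trans (bwd e eq here) (reach-sym q)
  reach-sym (bwd e eq q) = reach-trans (fwd e eq here) (reach-sym q)

  reach-invariant : ∀ {A : Set} (h : Fin n → A) {R u y} →
    (∀ e → R e ≡ false → h (src G e) ≡ h (dst G e)) →
    Reach G R u y → h y ≡ h u
  reach-invariant h agree here          = refl
  reach-invariant h agree (fwd e eq r) = trans (sym (agree e eq)) (reach-invariant h agree r)
  reach-invariant h agree (bwd e eq r) = trans (agree e eq) (reach-invariant h agree r)

  boundary-false : (X : Fin n → Bool) (e : Fin m) →
    X (src G e) ≡ X (dst G e) → boundary G X e ≡ false
  boundary-false X e eq rewrite eq with X (dst G e)
  ... | true  = refl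
  ... | false = refl

  boundary-agree : (X : Fin n → Bool) (e : Fin m) →
    boundary G X e ≡ false → X (src G e) ≡ X (dst G e)
  boundary-agree X e with X (src G e) | X (dst G e)
  ... | true  | true  = λ _ → refl
  ... | false | false = λ _ → refl
  ... | true  | false = λ ()
  ... | false | true  = λ ()

  boundary-separates : (X : Fin n → Bool) {u v : Fin n} →
    X u ≡ true → X v ≡ false → ¬ Reach G (boundary G X) u v
  boundary-separates X Xu Xv r with trans (reach-invariant X (boundary-agree X) r) Xu
  ... | Xv≡true = contradiction (trans (sym Xv) Xv≡true) λ ()

  same-block : ∀ {k} (f : Fin n → Fin k) e →
    cutEdges G f e ≡ false → f (src G e) ≡ f (dst G e)
  same-block f e with f (src G e) ≟ f (dst G e)
  ... | yes eq = λ _ → eq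
  ... | no  _  = λ ()

  blocks-boundary : ∀ {k} (f : Fin n → Fin k) (S : Fin k → Bool) e →
    cutEdges G f e ≡ false → boundary G (S ∘ f) e ≡ false
  blocks-boundary f S e uncut = boundary-false (S ∘ f) e (cong S (same-block f e uncut))

  component : ∀ {R s} → (∀ x → Dec (Reach G R s x)) → Fin n → Bool
  component reach? x = ⌊ reach? x ⌋

  component-self : ∀ {R s} (reach? : ∀ x → Dec (Reach G R s x)) → component reach? s ≡ true
  component-self {s = s} reach? with reach? s
  ... | yes _   = refl
  ... | no  s↛s = contradiction here s↛s

  component-outside : ∀ {R s x} (reach? : ∀ x → Dec (Reach G R s x)) →
    ¬ Reach G R s x → component reach? x ≡ false
  component-outside {x = x} reach? s↛x with reach? x
  ... | yes s→x = contradiction s→x s↛x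
  ... | no  _   = refl

  -- A component is closed in G ∖ R, so its boundary lies inside R.
  component-boundary : ∀ {R s} (reach? : ∀ x → Dec (Reach G R s x)) e →
    R e ≡ false → boundary G (component reach?) e ≡ false
  component-boundary reach? e uncut = boundary-false (component reach?) e closed
    where
    closed : component reach? (src G e) ≡ component reach? (dst G e)
    closed with reach? (src G e) | reach? (dst G e)
    ... | yes _   | yes _   = refl
    ... | no  _   | no  _   = refl
    ... | yes s→x | no  s↛y = contradiction (fwd e uncut s→x) s↛y
    ... | no  s↛x | yes s→y = contradiction (bwd e uncut s→y) s↛x

  boundary-indicator : (X : Fin n → Bool) (e : Fin m) →
    (if boundary G X e then w G e else 0) ≤ w G e * (ι (X (src G e)) + ι (X (dst G e)))
  boundary-indicator X e with X (src G e) | X (dst G e)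
  ... | true  | true  = z≤n
  ... | false | false = z≤n
  ... | true  | false = ≤-reflexive (sym (*-identityʳ (w G e)))
  ... | false | true  = ≤-reflexive (sym (*-identityʳ (w G e)))

  packing-lemma : (C : Fin m → Bool) (r : ℕ) (A : Fin r → Fin n → Bool) →
    (∀ x → sumFin r (λ j → ι (A j x)) ≤ 1) →
    (∀ j e → C e ≡ false → boundary G (A j) e ≡ false) →
    sumFin r (λ j → weightOf G (boundary G (A j))) ≤ 2 * weightOf G C
  packing-lemma C r A disjoint inside = begin
    sumFin r (λ j → weightOf G (boundary G (A j)))
      ≡⟨ sum-swap r m (λ j e → if boundary G (A j) e then w G e else 0) ⟩
    sumFin m (λ e → sumFin r (λ j → if boundary G (A j) e then w G e else 0))
      ≤⟨ sum-mono m per-edge ⟩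
    sumFin m (λ e → 2 * (if C e then w G e else 0))
      ≡⟨ sum-* m 2 (λ e → if C e then w G e else 0) ⟩
    2 * weightOf G C ∎
    where
    open ≤-Reasoning
    count : Fin n → ℕ
    count x = sumFin r (λ j → ι (A j x))
    endpoints : ∀ e → sumFin r (λ j → if boundary G (A j) e then w G e else 0)
                        ≤ w G e * (count (src G e) + count (dst G e))
    endpoints e = begin
      sumFin r (λ j → if boundary G (A j) e then w G e else 0)
        ≤⟨ sum-mono r (λ j → boundary-indicator (A j) e) ⟩
      sumFin r (λ j → w G e * (ι (A j (src G e)) + ι (A j (dst G e))))
        ≡⟨ sum-* r (w G e) _ ⟩
      w G e * sumFin r (λ j → ι (A j (src G e)) + ι (A j (dst G e)))
        ≡⟨ cong (w G e *_) (sum-+ r _ _) ⟩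
      w G e * (count (src G e) + count (dst G e)) ∎
    per-edge : ∀ e → sumFin r (λ j → if boundary G (A j) e then w G e else 0)
                       ≤ 2 * (if C e then w G e else 0)
    per-edge e with C e in eq
    ... | false = ≤-reflexive
                    (trans (sum-cong r (λ j → cong (λ z → if z then w G e else 0) (inside j e eq)))
                           (sum-zero r))
    ... | true = begin
      sumFin r (λ j → if boundary G (A j) e then w G e else 0)
        ≤⟨ endpoints e ⟩
      w G e * (count (src G e) + count (dst G e))
        ≤⟨ *-monoʳ-≤ (w G e) (+-mono-≤ (disjoint (src G e)) (disjoint (dst G e))) ⟩
      w G e * 2
        ≡⟨ *-comm (w G e) 2 ⟩
      2 * w G e ∎

ι-∧ : ∀ a c → ι (a ∧ c) ≡ (if c then ι a else 0)
ι-∧ true  true  = refl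
ι-∧ true  false = refl
ι-∧ false true  = refl
ι-∧ false false = refl

ι≤1 : ∀ a → ι a ≤ 1
ι≤1 true  = s≤s z≤n
ι≤1 false = z≤n

module Packing {n m k : ℕ} (G : Graph n m) (t : Fin k → Fin n) (f : Fin n → Fin k)
  (cut : IsMultiterminalCut G t f) (u v : Fin n)
  (apart : ¬ Reach G (cutEdges G f) u v)
  (reach-u? : ∀ x → Dec (Reach G (cutEdges G f) u x))
  (reach-v? : ∀ x → Dec (Reach G (cutEdges G f) v x)) where
  open Cuts G

  C : Fin m → Bool
  C = cutEdges G f

  p q : Fin k
  p = f u
  q = f v

  X Y : Fin n → Bool
  X = component reach-u?
  Y = component reach-v?

  block : Fin k → Fin n → Bool
  block i x = ⌊ f x ≟ i ⌋

  keep : Fin k → Bool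
  keep i = if ⌊ i ≟ p ⌋ then false else if ⌊ i ≟ q ⌋ then false else true

  keep-p : keep p ≡ false
  keep-p rewrite ≟-refl p = refl

  keep-q : keep q ≡ false
  keep-q with ⌊ q ≟ p ⌋
  ... | true  = refl
  ... | false rewrite ≟-refl q = refl

  family : Fin (suc (suc k)) → Fin n → Bool
  family zero            = X
  family (suc zero)      = Y
  family (suc (suc i)) x = keep i ∧ block i x

  family-disjoint : ∀ x → sumFin (suc (suc k)) (λ j → ι (family j x)) ≤ 1
  family-disjoint x = subst (λ s → ι (X x) + (ι (Y x) + s) ≤ 1) (sym kept-blocks)
                             (members (reach-u? x) (reach-v? x))
    where
    kept-blocks : sumFin k (λ i → ι (keep i ∧ block i x)) ≡ ι (keep (f x))
    kept-blocks = trans (sum-cong k (λ i → ι-∧ (keep i) (block i x)))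
                        (sum-point k (f x) (ι ∘ keep))
    in-block : ∀ {s} → Reach G C s x → f x ≡ f s
    in-block = reach-invariant f (same-block f)
    members : (u→x? : Dec (Reach G C u x)) (v→x? : Dec (Reach G C v x)) →
      ι ⌊ u→x? ⌋ + (ι ⌊ v→x? ⌋ + ι (keep (f x))) ≤ 1
    members (yes u→x) (yes v→x) = contradiction (reach-trans u→x (reach-sym v→x)) apart
    members (yes u→x) (no _) rewrite in-block u→x | keep-p = ≤-refl
    members (no _) (yes v→x) rewrite in-block v→x | keep-q = ≤-refl
    members (no _) (no _) = ι≤1 (keep (f x))

  family-inside : ∀ j e → C e ≡ false → boundary G (family j) e ≡ false
  family-inside zero          = component-boundary reach-u?
  family-inside (suc zero)    = component-boundary reach-v?
  family-inside (suc (suc i)) = blocks-boundary f (λ y → keep i ∧ ⌊ y ≟ i ⌋)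

  λ≤∂X : ∀ {a} → IsLambda G u v a → a ≤ weightOf G (boundary G X)
  λ≤∂X (_ , minimal) =
    minimal _ (boundary-separates X (component-self reach-u?) (component-outside reach-u? apart))

  λ≤∂Y : ∀ {a} → IsLambda G u v a → a ≤ weightOf G (boundary G Y)
  λ≤∂Y (_ , minimal) = minimal _
    (boundary-separates Y (component-self reach-v?) (component-outside reach-v? (apart ∘ reach-sym))
      ∘ reach-sym)

  λᵢ≤∂Vᵢ : ∀ {b i} → IsLambdaSet G (t i) (OtherTerminals t i) b →
    b ≤ weightOf G (boundary G (block i))
  λᵢ≤∂Vᵢ {i = i} (_ , minimal) = minimal (block i) terminal others
    where
    terminal : block i (t i) ≡ true
    terminal rewrite cut i = ≟-refl i
    others : ∀ x → OtherTerminals t i x → block i x ≡ false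
    others x (j , j≢i , refl) rewrite cut j = ≟-≢ j≢i

  kept-bound : ∀ (b : Fin k → ℕ) → (∀ i → IsLambdaSet G (t i) (OtherTerminals t i) (b i)) →
    ∀ i → (if ⌊ i ≟ p ⌋ then 0 else (if ⌊ i ≟ q ⌋ then 0 else b i))
          ≤ weightOf G (boundary G (family (suc (suc i))))
  kept-bound b λᵢ i with ⌊ i ≟ p ⌋ | ⌊ i ≟ q ⌋
  ... | true  | _     = z≤n
  ... | false | true  = z≤n
  ... | false | false = λᵢ≤∂Vᵢ (λᵢ i)

  packing-bound : ∀ {a} → IsLambda G u v a →
    (b : Fin k → ℕ) → (∀ i → IsLambdaSet G (t i) (OtherTerminals t i) (b i)) →
    a + (a + sumExcept2 b p q) ≤ 2 * weightOf G C
  packing-bound λuv b λᵢ =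
    ≤-trans (+-mono-≤ (λ≤∂X λuv) (+-mono-≤ (λ≤∂Y λuv) (sum-mono k (kept-bound b λᵢ))))
            (packing-lemma C (suc (suc k)) family family-disjoint family-inside)

double : ∀ a s s' W → s' ≤ s → a + (a + s) ≤ 2 * W → 4 * a + s' ≤ 4 * W
double a s s' W s'≤s h = begin
  4 * a + s'          ≤⟨ +-monoʳ-≤ (4 * a) (≤-trans s'≤s (m≤m+n s s)) ⟩
  4 * a + (s + s)     ≡⟨ doubled a s ⟩
  2 * (a + (a + s))   ≤⟨ *-monoʳ-≤ 2 h ⟩
  2 * (2 * W)         ≡⟨ sym (*-assoc 2 2 W) ⟩
  4 * W ∎
  where
  open ≤-Reasoning
  doubled : ∀ a s → 4 * a + (s + s) ≡ 2 * (a + (a + s))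
  doubled = solve 2 (λ a s → con 4 :* a :+ (s :+ s) := con 2 :* (a :+ (a :+ s))) refl

lemma3 : ∀ {n m k : ℕ} (G : Graph n m) → 2 ≤ k →
    (t : Fin k → Fin n) → Injective _≡_ _≡_ t →
    (f : Fin n → Fin k) → IsMinMultiterminalCut G t f →
    (u v : Fin n) → ¬ Reach G (cutEdges G f) u v →
    (a : ℕ) → IsLambda G u v a →
    (b : Fin k → ℕ) → (∀ i → IsLambdaSet G (t i) (OtherTerminals t i) (b i)) →
    (i₁ i₂ : Fin k) → i₁ ≢ i₂ →
    (∀ l → l ≢ i₁ → l ≢ i₂ → (b l ≤ b i₁) × (b l ≤ b i₂)) →
    4 * a + sumExcept2 b i₁ i₂ ≤ 4 * weightOf G (cutEdges G f)
lemma3 {n} G _ t _ f (cut , _) u v apart a λuv b λᵢ i₁ i₂ i₁≢i₂ largest =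
  decidable-stable (_ ≤? _) λ fails →
  ¬¬-decide-all n (Reach G (cutEdges G f) u) λ reach-u? →
  ¬¬-decide-all n (Reach G (cutEdges G f) v) λ reach-v? →
  let open Packing G t f cut u v apart reach-u? reach-v? in
  fails (double a (sumExcept2 b p q) (sumExcept2 b i₁ i₂) (weightOf G C)
          (sumExcept2-minimal _ b i₁≢i₂ largest p q)
          (packing-bound λuv b λᵢ))
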